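{- In the weak order on $\mathfrak{S}_n$, for every arc $\alpha$ we have $\kappa_\vee(\sigma_\wedge(\alpha))=\sigma_\vee(\alpha)$ and $\kappa_\wedge(\sigma_\vee(\alpha))=\sigma_\wedge(\alpha)$.
   Context: An inversion of $\sigma\in\mathfrak{S}_n$ is a pair $(u,v)$ with $1\le u<v\le n$ and $\sigma^{ -1}(u)>\sigma^{ -1}(v)$; the (right) weak order is $\sigma\le\tau$ iff the inversion set of $\sigma$ is contained in that of $\tau$. It is a finite semidistributive lattice. An arc is a quadruple $\alpha=(a,b,A,B)$ with $1\le a<b\le n$ and $A\sqcup B=\{a+1,\dots,b-1\}$. Writing $A=\{a_1<\dots<a_k\}$, $B=\{b_1<\dots<b_\ell\}$ and using one-line notation, $\sigma_\vee(\alpha)=[1,\dots,a-1,a_1,\dots,a_k,b,a,b_1,\dots,b_\ell,b+1,\dots,n]$ (a join irreducible permutation) and $\sigma_\wedge(\alpha)=[n,\dots,b+1,a_k,\dots,a_1,a,b,b_\ell,\dots,b_1,a-1,\dots,1]$ (a meet irreducible permutation). In a finite lattice, a join irreducible $j$ covers a unique element $j_\star$ and a meet irreducible $m$ is covered by a unique element $m^\star$; $\kappa_\vee(m)$ is the unique minimal element of $\{z: z\le m^\star, z\not\le m\}$ and $\kappa_\wedge(j)$ is the unique maximal element of $\{z: z\ge j_\star, z\not\ge j\}$. -}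

module Defs where

open import Data.Nat using (ℕ; suc; _+_; _∸_; _<_; _≤_)
open import Data.List using (List; []; _∷_; _++_; applyUpTo; reverse)
open import Data.List.Relation.Binary.Permutation.Propositional using (_↭_)
open import Data.List.Relation.Unary.AllPairs using (AllPairs)
open import Data.Product using (Σ; ∃; _×_; ∃-syntax)
open import Data.Sum using (_⊎_)
open import Relation.Binary.PropositionalEquality using (_≡_; _≢_)
open import Relation.Nullary using (¬_)

-- Permutations of {1,…,n} in one-line notation: lists that are a
-- rearrangement of [1,…,n].
[1‥_] : ℕ → List ℕ
[1‥ n ] = applyUpTo suc n

[_+1‥+_] : ℕ → ℕ → List ℕ
[ a +1‥+ k ] = applyUpTo (λ i → a + suc i) k

IsPerm : ℕ → List ℕ → Set
IsPerm n σ = σ ↭ [1‥ n ]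

Inv : List ℕ → ℕ → ℕ → Set
Inv σ u v = u < v × ∃[ l₁ ] ∃[ l₂ ] ∃[ l₃ ] (σ ≡ l₁ ++ (v ∷ l₂) ++ (u ∷ l₃))

-- right weak order: containment of inversion sets
_≤w_ : List ℕ → List ℕ → Set
σ ≤w τ = ∀ u v → Inv σ u v → Inv τ u v

Covers : ℕ → List ℕ → List ℕ → Set
Covers n σ τ =
  IsPerm n σ × IsPerm n τ × σ ≤w τ × σ ≢ τ ×
  (∀ z → IsPerm n z → σ ≤w z → z ≤w τ → (z ≡ σ) ⊎ (z ≡ τ))

IsMinimal : (List ℕ → Set) → List ℕ → Set
IsMinimal S x = S x × (∀ w → S w → w ≤w x → w ≡ x)

IsMaximal : (List ℕ → Set) → List ℕ → Set
IsMaximal S x = S x × (∀ w → S w → x ≤w w → w ≡ x)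

IsUniqueMinimal : (List ℕ → Set) → List ℕ → Set
IsUniqueMinimal S x = IsMinimal S x × (∀ y → IsMinimal S y → y ≡ x)

IsUniqueMaximal : (List ℕ → Set) → List ℕ → Set
IsUniqueMaximal S x = IsMaximal S x × (∀ y → IsMaximal S y → y ≡ x)

-- κ∨(m) = k : m is meet irreducible (a permutation covered by a unique
-- element m*), and k is the unique minimal element of
-- { z ∈ 𝔖ₙ : z ≤ m*, z ≰ m }.
KappaVee : ℕ → List ℕ → List ℕ → Set
KappaVee n m k =
  IsPerm n m ×
  Σ (List ℕ) λ m* → Covers n m m* × (∀ y → Covers n m y → y ≡ m*) ×
    IsUniqueMinimal (λ z → IsPerm n z × z ≤w m* × ¬ (z ≤w m)) k

-- κ∧(j) = k : j is join irreducible (a permutation covering a unique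
-- element j⋆), and k is the unique maximal element of
-- { z ∈ 𝔖ₙ : z ≥ j⋆, z ≱ j }.
KappaWedge : ℕ → List ℕ → List ℕ → Set
KappaWedge n j k =
  IsPerm n j ×
  Σ (List ℕ) λ j⋆ → Covers n j⋆ j × (∀ y → Covers n y j → y ≡ j⋆) ×
    IsUniqueMaximal (λ z → IsPerm n z × j⋆ ≤w z × ¬ (j ≤w z)) k

-- An arc (a, b, A, B) on {1,…,n}: 1 ≤ a < b ≤ n and A ⊔ B = {a+1,…,b-1};
-- A and B are given as strictly increasing lists.
record Arc (n : ℕ) : Set where
  field
    a b : ℕ
    1≤a : 1 ≤ a
    a<b : a < b
    b≤n : b ≤ n
    A B : List ℕ
    A-incr : AllPairs _<_ A
    B-incr : AllPairs _<_ B
    partition : (A ++ B) ↭ [ a +1‥+ (b ∸ a ∸ 1) ]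

open Arc

σ∨ : ∀ {n} → Arc n → List ℕ
σ∨ {n} α = [1‥ (a α ∸ 1) ] ++ A α ++ (b α ∷ a α ∷ (B α ++ [ b α +1‥+ (n ∸ b α) ]))

σ∧ : ∀ {n} → Arc n → List ℕ
σ∧ {n} α = reverse [ b α +1‥+ (n ∸ b α) ] ++ reverse (A α)
           ++ (a α ∷ b α ∷ (reverse (B α) ++ reverse [1‥ (a α ∸ 1) ]))

-- Swapping an adjacent pair x < y adds exactly the inversion (x , y), so it
-- is a cover.  σ∨(α) is the least permutation with A before b before a before
-- B, and σ∧(α) the greatest one with A before a before b before B.  Swapping a
-- and b in σ∧(α) gives its only upper cover m*; a permutation below m* but not
-- below σ∧(α) has b before a, and being below m* it keeps A before b and a
-- before B, so it lies above σ∨(α).  Reversing the one-line notation is an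
-- order-reversing involution exchanging σ∨(α) with σ∧ of the arc whose A and B
-- are swapped; it turns κ∨ for that arc into κ∧ for α.
module Submission where

open import Defs
open import Data.Nat using (ℕ; zero; suc; _+_; _∸_; _<_; _≤_; z≤n; s≤s)
open import Data.Nat.Properties
  using (<-cmp; <-asym; <-trans; <⇒≢; <⇒≤; ≤-refl; ≤-trans; ≤-reflexive; <-≤-trans;
         +-suc; +-assoc; +-comm; +-identityʳ; +-monoʳ-≤; +-monoʳ-<; m<m+n; ∸-+-assoc; m+[n∸m]≡n)
open import Data.List using (List; []; _∷_; _++_; [_]; applyUpTo; reverse)
open import Data.List.Properties
  using (++-assoc; unfold-reverse; reverse-++; reverse-involutive; reverse-selfInverse; reverse-injective)
open import Data.List.Membership.Propositional using (_∈_)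
open import Data.List.Membership.Propositional.Properties
  using (∈-++⁺ˡ; ∈-++⁺ʳ; ∈-++⁻; ∈-∃++; ∈-applyUpTo⁻)
open import Data.List.Relation.Binary.Subset.Propositional using (_⊆_)
open import Data.List.Relation.Binary.Permutation.Propositional
  using (_↭_; ↭-refl; ↭-sym; ↭-trans; prep; swap; ↭⇒↭ₛ; module PermutationReasoning)
open import Data.List.Relation.Binary.Permutation.Propositional.Properties
  using (∈-resp-↭; ↭-reverse; ++-comm; ++⁺ˡ; ++⁺ʳ; ++-commutativeMonoid)
open import Data.List.Relation.Binary.Permutation.Setoid.Properties using (Unique-resp-↭)
open import Data.List.Relation.Unary.Any using (here; there)
import Data.List.Relation.Unary.Any.Properties as Any
import Data.List.Relation.Unary.All as All
open import Data.List.Relation.Unary.All.Properties using (All¬⇒¬Any)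
open import Data.List.Relation.Unary.AllPairs using (AllPairs; []; _∷_)
import Data.List.Relation.Unary.AllPairs as AllPairs
import Data.List.Relation.Unary.AllPairs.Properties as AllPairs
open import Data.List.Relation.Unary.Unique.Propositional using (Unique)
open import Data.Product using (_×_; _,_; proj₁; proj₂; ∃-syntax)
import Data.Product as Product
open import Data.Sum using (_⊎_; inj₁; inj₂)
import Data.Sum as Sum
open import Data.Empty using (⊥; ⊥-elim)
open import Relation.Binary.Core using (Rel)
open import Relation.Binary.Definitions using (tri<; tri≈; tri>)
open import Relation.Binary.PropositionalEquality
  using (_≡_; _≢_; refl; sym; trans; cong; cong₂; subst; subst₂; module ≡-Reasoning)
open import Relation.Binary.PropositionalEquality.Properties using (setoid)
open import Relation.Nullary using (¬_)
open import Algebra.Solver.CommutativeMonoid (++-commutativeMonoid {A = ℕ}) using (solve; _⊜_; _⊕_)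

module _ {A : Set} where

  data Before : List A → A → A → Set where
    first : ∀ {x y l} → y ∈ l → Before (x ∷ l) x y
    later : ∀ {w x y l} → Before l x y → Before (w ∷ l) x y

  Before-∈ˡ : ∀ {l x y} → Before l x y → x ∈ l
  Before-∈ˡ (first _) = here refl
  Before-∈ˡ (later p) = there (Before-∈ˡ p)

  Before-∈ʳ : ∀ {l x y} → Before l x y → y ∈ l
  Before-∈ʳ (first y∈l) = there y∈l
  Before-∈ʳ (later p) = there (Before-∈ʳ p)

  Before-asym : ∀ {l x y} → Unique l → Before l x y → Before l y x → ⊥
  Before-asym (hd∉l ∷ _) (first _) (first x∈l) = All¬⇒¬Any hd∉l x∈l
  Before-asym (hd∉l ∷ _) (first _) (later q) = All¬⇒¬Any hd∉l (Before-∈ʳ q)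
  Before-asym (hd∉l ∷ _) (later p) (first _) = All¬⇒¬Any hd∉l (Before-∈ʳ p)
  Before-asym (_ ∷ u) (later p) (later q) = Before-asym u p q

  Before-trans : ∀ {l x y z} → Unique l → Before l x y → Before l y z → Before l x z
  Before-trans (hd∉l ∷ _) (first y∈l) (first _) = ⊥-elim (All¬⇒¬Any hd∉l y∈l)
  Before-trans (_ ∷ _) (first _) (later q) = first (Before-∈ʳ q)
  Before-trans (hd∉l ∷ _) (later p) (first _) = ⊥-elim (All¬⇒¬Any hd∉l (Before-∈ʳ p))
  Before-trans (_ ∷ u) (later p) (later q) = later (Before-trans u p q)

  Before-total : ∀ {l x y} → x ∈ l → y ∈ l → x ≢ y → Before l x y ⊎ Before l y x
  Before-total (here refl) (here refl) x≢y = ⊥-elim (x≢y refl)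
  Before-total (here refl) (there y∈l) _ = inj₁ (first y∈l)
  Before-total (there x∈l) (here refl) _ = inj₂ (first x∈l)
  Before-total (there x∈l) (there y∈l) x≢y = Sum.map later later (Before-total x∈l y∈l x≢y)

  Before⇒split : ∀ {l x y} → Before l x y →
                 ∃[ l₁ ] ∃[ l₂ ] ∃[ l₃ ] (l ≡ l₁ ++ (x ∷ l₂) ++ (y ∷ l₃))
  Before⇒split (first y∈l) with l₂ , l₃ , refl ← ∈-∃++ y∈l = [] , l₂ , l₃ , refl
  Before⇒split {w ∷ _} (later p) with l₁ , l₂ , l₃ , refl ← Before⇒split p =
    w ∷ l₁ , l₂ , l₃ , refl

  split⇒Before : ∀ l₁ {l₂ l₃ l x y} → l ≡ l₁ ++ (x ∷ l₂) ++ (y ∷ l₃) → Before l x y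
  split⇒Before [] {l₂} refl = first (∈-++⁺ʳ l₂ (here refl))
  split⇒Before (_ ∷ l₁) refl = later (split⇒Before l₁ refl)

  Before-++⁻ : ∀ X {Y x y} → Before (X ++ Y) x y →
               Before X x y ⊎ (x ∈ X × y ∈ Y) ⊎ Before Y x y
  Before-++⁻ [] p = inj₂ (inj₂ p)
  Before-++⁻ (_ ∷ X) (first y∈XY) with ∈-++⁻ X y∈XY
  ... | inj₁ y∈X = inj₁ (first y∈X)
  ... | inj₂ y∈Y = inj₂ (inj₁ (here refl , y∈Y))
  Before-++⁻ (_ ∷ X) (later p) with Before-++⁻ X p
  ... | inj₁ q = inj₁ (later q)
  ... | inj₂ (inj₁ (x∈X , y∈Y)) = inj₂ (inj₁ (there x∈X , y∈Y))
  ... | inj₂ (inj₂ q) = inj₂ (inj₂ q)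

  Before-++⁺ʳ : ∀ X {Y x y} → Before Y x y → Before (X ++ Y) x y
  Before-++⁺ʳ [] p = p
  Before-++⁺ʳ (_ ∷ X) p = later (Before-++⁺ʳ X p)

  Before-++⁺ : ∀ {X Y x y} → x ∈ X → y ∈ Y → Before (X ++ Y) x y
  Before-++⁺ {_ ∷ X} (here refl) y∈Y = first (∈-++⁺ʳ X y∈Y)
  Before-++⁺ {_ ∷ X} (there x∈X) y∈Y = later (Before-++⁺ x∈X y∈Y)

  Before-reverse⁻ : ∀ l {x y} → Before (reverse l) x y → Before l y x
  Before-reverse⁻ (w ∷ l) {x} {y} p
    with Before-++⁻ (reverse l) (subst (λ l′ → Before l′ x y) (unfold-reverse w l) p)
  ... | inj₁ q = later (Before-reverse⁻ l q)
  ... | inj₂ (inj₁ (x∈l , here refl)) = first (Any.reverse⁻ x∈l)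
  ... | inj₂ (inj₂ (later ()))

  Before-reverse⁺ : ∀ {l x y} → Before l x y → Before (reverse l) y x
  Before-reverse⁺ {l} {x} {y} p =
    Before-reverse⁻ (reverse l) (subst (λ l′ → Before l′ x y) (sym (reverse-involutive l)) p)

  AllPairs-Before : ∀ {ℓ} {R : Rel A ℓ} {l x y} → AllPairs R l → Before l x y → R x y
  AllPairs-Before (Rx ∷ _) (first y∈l) = All.lookup Rx y∈l
  AllPairs-Before (_ ∷ R-l) (later p) = AllPairs-Before R-l p

_≼_ : List ℕ → List ℕ → Set
σ ≼ τ = ∀ {u v} → u < v → Before σ v u → Before τ v u

≤w⇒≼ : ∀ {σ τ} → σ ≤w τ → σ ≼ τ
≤w⇒≼ σ≤τ {u} {v} u<v p with _ , l₁ , _ , _ , eq ← σ≤τ u v (u<v , Before⇒split p) =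
  split⇒Before l₁ eq

≼⇒≤w : ∀ {σ τ} → σ ≼ τ → σ ≤w τ
≼⇒≤w σ≼τ u v (u<v , l₁ , _ , _ , eq) = u<v , Before⇒split (σ≼τ u<v (split⇒Before l₁ eq))

≼-≽-agree : ∀ {σ τ x y} → Unique σ → Unique τ → σ ≼ τ → τ ≼ σ →
            Before σ x y → Before τ y x → ⊥
≼-≽-agree {x = x} {y} uσ uτ σ≼τ τ≼σ σxy τyx with <-cmp x y
... | tri< x<y _ _ = Before-asym uσ σxy (τ≼σ x<y τyx)
... | tri≈ _ refl _ = Before-asym uσ σxy σxy
... | tri> _ _ y<x = Before-asym uτ (σ≼τ y<x σxy) τyx

∷-⊆⁻ : ∀ {x : ℕ} {σ τ} → Unique (x ∷ σ) → (x ∷ σ) ⊆ (x ∷ τ) → σ ⊆ τ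
∷-⊆⁻ (x∉σ ∷ _) ⊆ e∈σ with ⊆ (there e∈σ)
... | here refl = ⊥-elim (All¬⇒¬Any x∉σ e∈σ)
... | there e∈τ = e∈τ

∷-≼⁻ : ∀ {x σ τ} → Unique (x ∷ σ) → (x ∷ σ) ≼ (x ∷ τ) → σ ≼ τ
∷-≼⁻ (x∉σ ∷ _) ≼ u<v p with ≼ u<v (later p)
... | first _ = ⊥-elim (All¬⇒¬Any x∉σ (Before-∈ˡ p))
... | later q = q

≼-antisym-head : ∀ {x y σ τ} → Unique (x ∷ σ) → Unique (y ∷ τ) →
                 (x ∷ σ) ⊆ (y ∷ τ) → (y ∷ τ) ⊆ (x ∷ σ) →
                 (x ∷ σ) ≼ (y ∷ τ) → (y ∷ τ) ≼ (x ∷ σ) → x ≡ y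
≼-antisym-head uσ uτ σ⊆τ τ⊆σ σ≼τ τ≼σ with σ⊆τ (here refl) | τ⊆σ (here refl)
... | here x≡y | _ = x≡y
... | there _ | here y≡x = sym y≡x
... | there x∈τ | there y∈σ =
  ⊥-elim (≼-≽-agree uσ uτ σ≼τ τ≼σ (first y∈σ) (first x∈τ))

≼-antisym : ∀ {σ τ} → Unique σ → Unique τ → σ ⊆ τ → τ ⊆ σ →
            σ ≼ τ → τ ≼ σ → σ ≡ τ
≼-antisym {[]} {[]} _ _ _ _ _ _ = refl
≼-antisym {[]} {_ ∷ _} _ _ _ τ⊆σ _ _ with () ← τ⊆σ (here refl)
≼-antisym {_ ∷ _} {[]} _ _ σ⊆τ _ _ _ with () ← σ⊆τ (here refl)
≼-antisym {x ∷ σ} {y ∷ τ} uσ uτ σ⊆τ τ⊆σ σ≼τ τ≼σ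
  with refl ← ≼-antisym-head uσ uτ σ⊆τ τ⊆σ σ≼τ τ≼σ =
  cong (x ∷_) (≼-antisym (AllPairs.tail uσ) (AllPairs.tail uτ)
                         (∷-⊆⁻ uσ σ⊆τ) (∷-⊆⁻ uτ τ⊆σ) (∷-≼⁻ uσ σ≼τ) (∷-≼⁻ uτ τ≼σ))

applyUpTo-cong : ∀ {A : Set} {f g : ℕ → A} → (∀ i → f i ≡ g i) →
                 ∀ k → applyUpTo f k ≡ applyUpTo g k
applyUpTo-cong f≗g zero = refl
applyUpTo-cong f≗g (suc k) = cong₂ _∷_ (f≗g 0) (applyUpTo-cong (λ i → f≗g (suc i)) k)

applyUpTo-++ : ∀ {A : Set} (f : ℕ → A) k l →
               applyUpTo f (k + l) ≡ applyUpTo f k ++ applyUpTo (λ i → f (k + i)) l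
applyUpTo-++ f zero l = refl
applyUpTo-++ f (suc k) l = cong (f 0 ∷_) (applyUpTo-++ (λ i → f (suc i)) k l)

[+1‥+]-split : ∀ c k l {x} → c + suc k ≡ x →
               [ c +1‥+ (k + suc l) ] ≡ [ c +1‥+ k ] ++ x ∷ [ x +1‥+ l ]
[+1‥+]-split c k l refl =
  trans (applyUpTo-++ _ k (suc l)) (cong ([ c +1‥+ k ] ++_) (cong₂ _∷_ head-≡ tail-≡))
  where
  head-≡ : c + suc (k + 0) ≡ c + suc k
  head-≡ = cong (λ t → c + suc t) (+-identityʳ k)
  tail-≡ : applyUpTo (λ i → c + suc (k + suc i)) l ≡ [ c + suc k +1‥+ l ]
  tail-≡ = applyUpTo-cong (λ i → sym (+-assoc c (suc k) (suc i))) l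

∈-[+1‥+]⁻ : ∀ {c k e} → e ∈ [ c +1‥+ k ] → c < e × e ≤ c + k
∈-[+1‥+]⁻ {c} e∈ with i , i<k , refl ← ∈-applyUpTo⁻ (λ i → c + suc i) e∈ =
  m<m+n c (s≤s z≤n) , +-monoʳ-≤ c i<k

[+1‥+]-sorted : ∀ c k → AllPairs _<_ [ c +1‥+ k ]
[+1‥+]-sorted c k = AllPairs.applyUpTo⁺₁ _ k (λ i<j _ → +-monoʳ-< c (s≤s i<j))

m+suc[n∸m∸1]≡n : ∀ {m n} → m < n → m + suc (n ∸ m ∸ 1) ≡ n
m+suc[n∸m∸1]≡n {m} {n} m<n = begin
  m + suc (n ∸ m ∸ 1)  ≡⟨ +-suc m _ ⟩
  suc m + (n ∸ m ∸ 1)  ≡⟨ cong (suc m +_) (trans (∸-+-assoc n m 1) (cong (n ∸_) (+-comm m 1))) ⟩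
  suc m + (n ∸ suc m)  ≡⟨ m+[n∸m]≡n m<n ⟩
  n                    ∎
  where open ≡-Reasoning

∈-[+1‥+]-gap : ∀ {c d e} → c < d → e ∈ [ c +1‥+ (d ∸ c ∸ 1) ] → c < e × e < d
∈-[+1‥+]-gap {c} {d} c<d e∈ with c<e , e≤ ← ∈-[+1‥+]⁻ e∈ =
  c<e , ≤-trans (s≤s e≤) (≤-reflexive (trans (sym (+-suc c _)) (m+suc[n∸m∸1]≡n c<d)))

[1‥]-decompose : ∀ {a b n} → 1 ≤ a → a < b → b ≤ n →
  [1‥ n ] ≡ [1‥ (a ∸ 1) ] ++ a ∷ [ a +1‥+ (b ∸ a ∸ 1) ] ++ b ∷ [ b +1‥+ (n ∸ b) ]
[1‥]-decompose {a} {b} {n} 1≤a a<b b≤n = begin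
  [1‥ n ]
    ≡⟨ cong [1‥_] (sym length-≡) ⟩
  [1‥ ((a ∸ 1) + suc (d + suc e)) ]
    ≡⟨ [+1‥+]-split 0 (a ∸ 1) _ (m+[n∸m]≡n 1≤a) ⟩
  [1‥ (a ∸ 1) ] ++ a ∷ [ a +1‥+ (d + suc e) ]
    ≡⟨ cong (λ t → [1‥ (a ∸ 1) ] ++ a ∷ t) ([+1‥+]-split a d e (m+suc[n∸m∸1]≡n a<b)) ⟩
  [1‥ (a ∸ 1) ] ++ a ∷ [ a +1‥+ d ] ++ b ∷ [ b +1‥+ e ] ∎
  where
  open ≡-Reasoning
  d = b ∸ a ∸ 1
  e = n ∸ b
  length-≡ : (a ∸ 1) + suc (d + suc e) ≡ n
  length-≡ = begin
    (a ∸ 1) + suc (d + suc e)  ≡⟨ +-suc (a ∸ 1) _ ⟩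
    (1 + (a ∸ 1)) + (d + suc e) ≡⟨ cong (_+ (d + suc e)) (m+[n∸m]≡n 1≤a) ⟩
    a + (d + suc e)            ≡⟨ sym (+-assoc a d (suc e)) ⟩
    (a + d) + suc e            ≡⟨ +-suc (a + d) e ⟩
    suc (a + d) + e            ≡⟨ cong (_+ e) (sym (+-suc a d)) ⟩
    (a + suc d) + e            ≡⟨ cong (_+ e) (m+suc[n∸m∸1]≡n a<b) ⟩
    b + e                      ≡⟨ m+[n∸m]≡n b≤n ⟩
    n                          ∎

module _ {n : ℕ} where

  IsPerm⇒Unique : ∀ {σ} → IsPerm n σ → Unique σ
  IsPerm⇒Unique σ↭ =
    Unique-resp-↭ (setoid ℕ) (↭⇒↭ₛ (↭-sym σ↭)) (AllPairs.map <⇒≢ ([+1‥+]-sorted 0 n))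

  IsPerm-⊆ : ∀ {σ τ} → IsPerm n σ → IsPerm n τ → σ ⊆ τ
  IsPerm-⊆ σ↭ τ↭ = ∈-resp-↭ (↭-trans σ↭ (↭-sym τ↭))

  IsPerm-reverse : ∀ {σ} → IsPerm n σ → IsPerm n (reverse σ)
  IsPerm-reverse {σ} σ↭ = ↭-trans (↭-reverse σ) σ↭

  IsPerm-reverse⁻ : ∀ {σ} → IsPerm n (reverse σ) → IsPerm n σ
  IsPerm-reverse⁻ {σ} σʳ↭ = ↭-trans (↭-sym (↭-reverse σ)) σʳ↭

  IsPerm-≼-antisym : ∀ {σ τ} → IsPerm n σ → IsPerm n τ → σ ≼ τ → τ ≼ σ → σ ≡ τ
  IsPerm-≼-antisym pσ pτ =
    ≼-antisym (IsPerm⇒Unique pσ) (IsPerm⇒Unique pτ) (IsPerm-⊆ pσ pτ) (IsPerm-⊆ pτ pσ)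

  IsPerm-≼-ascent : ∀ {σ τ x y} → IsPerm n σ → IsPerm n τ → σ ≼ τ →
                    x < y → Before τ x y → Before σ x y
  IsPerm-≼-ascent pσ pτ σ≼τ x<y τxy
    with Before-total (IsPerm-⊆ pτ pσ (Before-∈ˡ τxy)) (IsPerm-⊆ pτ pσ (Before-∈ʳ τxy))
                      (<⇒≢ x<y)
  ... | inj₁ σxy = σxy
  ... | inj₂ σyx = ⊥-elim (Before-asym (IsPerm⇒Unique pτ) τxy (σ≼τ x<y σyx))

  ≼-reverse : ∀ {σ τ} → IsPerm n σ → IsPerm n τ → σ ≼ τ → reverse τ ≼ reverse σ
  ≼-reverse {σ} {τ} pσ pτ σ≼τ u<v τʳvu =
    Before-reverse⁺ (IsPerm-≼-ascent pσ pτ σ≼τ u<v (Before-reverse⁻ τ τʳvu))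

  reverse-≼ : ∀ {σ τ} → IsPerm n σ → IsPerm n τ → reverse σ ≼ reverse τ → τ ≼ σ
  reverse-≼ {σ} {τ} pσ pτ σʳ≼τʳ = subst₂ _≼_ (reverse-involutive τ) (reverse-involutive σ)
    (≼-reverse (IsPerm-reverse pσ) (IsPerm-reverse pτ) σʳ≼τʳ)

  ≼-reverseˡ : ∀ {σ τ} → IsPerm n σ → IsPerm n τ → reverse σ ≼ τ → reverse τ ≼ σ
  ≼-reverseˡ {σ} pσ pτ σʳ≼τ =
    subst (_ ≼_) (reverse-involutive σ) (≼-reverse (IsPerm-reverse pσ) pτ σʳ≼τ)

  ≼-reverseʳ : ∀ {σ τ} → IsPerm n σ → IsPerm n τ → σ ≼ reverse τ → τ ≼ reverse σ
  ≼-reverseʳ {τ = τ} pσ pτ σ≼τʳ =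
    subst (_≼ _) (reverse-involutive τ) (≼-reverse pσ (IsPerm-reverse pτ) σ≼τʳ)

data Transposition (x y : ℕ) : List ℕ → List ℕ → Set where
  swap-head : ∀ {l} → Transposition x y (x ∷ y ∷ l) (y ∷ x ∷ l)
  swap-tail : ∀ {w l l′} → Transposition x y l l′ → Transposition x y (w ∷ l) (w ∷ l′)

Transposition-++ : ∀ {x y l l′} X → Transposition x y l l′ → Transposition x y (X ++ l) (X ++ l′)
Transposition-++ [] t = t
Transposition-++ (_ ∷ X) t = swap-tail (Transposition-++ X t)

Transposition-sym : ∀ {x y l l′} → Transposition x y l l′ → Transposition y x l′ l
Transposition-sym swap-head = swap-head
Transposition-sym (swap-tail t) = swap-tail (Transposition-sym t)

Transposition-↭ : ∀ {x y l l′} → Transposition x y l l′ → l ↭ l′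
Transposition-↭ swap-head = swap _ _ ↭-refl
Transposition-↭ (swap-tail t) = prep _ (Transposition-↭ t)

Transposition-Before : ∀ {x y l l′} → Transposition x y l l′ → Before l x y
Transposition-Before swap-head = first (here refl)
Transposition-Before (swap-tail t) = later (Transposition-Before t)

Transposition-Before⁻ : ∀ {x y l l′ u v} → Transposition x y l l′ → Before l v u →
                        Before l′ v u ⊎ (v ≡ x × u ≡ y)
Transposition-Before⁻ swap-head (first (here refl)) = inj₂ (refl , refl)
Transposition-Before⁻ swap-head (first (there u∈l)) = inj₁ (later (first u∈l))
Transposition-Before⁻ swap-head (later (first u∈l)) = inj₁ (first (there u∈l))
Transposition-Before⁻ swap-head (later (later p)) = inj₁ (later (later p))
Transposition-Before⁻ (swap-tail t) (first u∈l) =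
  inj₁ (first (∈-resp-↭ (Transposition-↭ t) u∈l))
Transposition-Before⁻ (swap-tail t) (later p) = Sum.map₁ later (Transposition-Before⁻ t p)

Transposition-≢ : ∀ {x y l l′} → Unique l → Transposition x y l l′ → l ≢ l′
Transposition-≢ ul t refl =
  Before-asym ul (Transposition-Before t) (Transposition-Before (Transposition-sym t))

≼-Transposition : ∀ {x y l l′} → x < y → Transposition x y l l′ → l ≼ l′
≼-Transposition x<y t u<v p with Transposition-Before⁻ t p
... | inj₁ q = q
... | inj₂ (refl , refl) = ⊥-elim (<-asym x<y u<v)

≼-Transposition-below : ∀ {x y l l′ σ} → Unique σ → Transposition x y l l′ →
                        σ ≼ l′ → Before σ x y → σ ≼ l
≼-Transposition-below uσ t σ≼l′ σxy u<v p
  with Transposition-Before⁻ (Transposition-sym t) (σ≼l′ u<v p)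
... | inj₁ q = q
... | inj₂ (refl , refl) = ⊥-elim (Before-asym uσ σxy p)

≼-Transposition-above : ∀ {x y l l′ σ} → Transposition x y l l′ →
                        l ≼ σ → Before σ y x → l′ ≼ σ
≼-Transposition-above t l≼σ σyx u<v p with Transposition-Before⁻ (Transposition-sym t) p
... | inj₁ q = l≼σ u<v q
... | inj₂ (refl , refl) = σyx

module _ {n : ℕ} where

  Transposition-IsPerm : ∀ {x y l l′} → IsPerm n l → Transposition x y l l′ → IsPerm n l′
  Transposition-IsPerm pl t = ↭-trans (↭-sym (Transposition-↭ t)) pl

  Transposition-Before-total : ∀ {x y l l′ σ} → x < y → IsPerm n l → IsPerm n σ →
                               Transposition x y l l′ → Before σ x y ⊎ Before σ y x
  Transposition-Before-total x<y pl pσ t =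
    Before-total (IsPerm-⊆ pl pσ (Before-∈ˡ (Transposition-Before t)))
                 (IsPerm-⊆ pl pσ (Before-∈ʳ (Transposition-Before t))) (<⇒≢ x<y)

  Transposition-Covers : ∀ {x y l l′} → x < y → IsPerm n l → Transposition x y l l′ →
                         Covers n l l′
  Transposition-Covers {l = l} {l′} x<y pl t =
    pl , pl′ , ≼⇒≤w (≼-Transposition x<y t) , Transposition-≢ (IsPerm⇒Unique pl) t , between
    where
    pl′ = Transposition-IsPerm pl t
    between : ∀ σ → IsPerm n σ → l ≤w σ → σ ≤w l′ → σ ≡ l ⊎ σ ≡ l′
    between σ pσ l≤σ σ≤l′ with Transposition-Before-total x<y pl pσ t
    ... | inj₁ σxy = inj₁ (IsPerm-≼-antisym pσ pl
                             (≼-Transposition-below (IsPerm⇒Unique pσ) t (≤w⇒≼ σ≤l′) σxy) (≤w⇒≼ l≤σ))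
    ... | inj₂ σyx = inj₂ (IsPerm-≼-antisym pσ pl′
                             (≤w⇒≼ σ≤l′) (≼-Transposition-above t (≤w⇒≼ l≤σ) σyx))

  Transposition-¬≼ : ∀ {x y l l′ σ} → x < y → IsPerm n l → IsPerm n σ →
                     Transposition x y l l′ → σ ≼ l′ → ¬ σ ≼ l → Before σ y x
  Transposition-¬≼ x<y pl pσ t σ≼l′ σ⋠l with Transposition-Before-total x<y pl pσ t
  ... | inj₁ σxy = ⊥-elim (σ⋠l (≼-Transposition-below (IsPerm⇒Unique pσ) t σ≼l′ σxy))
  ... | inj₂ σyx = σyx

  Transposition-unique-cover : ∀ {x y l l′} → x < y → IsPerm n l → Transposition x y l l′ →
    (∀ σ → IsPerm n σ → l ≼ σ → Before σ x y → σ ≼ l) → ∀ τ → Covers n l τ → τ ≡ l′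
  Transposition-unique-cover x<y pl t maximal τ (_ , pτ , l≤τ , l≢τ , between)
    with Transposition-Before-total x<y pl pτ t
  ... | inj₁ τxy =
    ⊥-elim (l≢τ (IsPerm-≼-antisym pl pτ (≤w⇒≼ l≤τ) (maximal τ pτ (≤w⇒≼ l≤τ) τxy)))
  ... | inj₂ τyx with between _ (Transposition-IsPerm pl t) (≼⇒≤w (≼-Transposition x<y t))
                              (≼⇒≤w (≼-Transposition-above t (≤w⇒≼ l≤τ) τyx))
  ...   | inj₁ l′≡l = ⊥-elim (Transposition-≢ (IsPerm⇒Unique pl) t (sym l′≡l))
  ...   | inj₂ l′≡τ = sym l′≡τ

  least⇒IsUniqueMinimal : ∀ {S : List ℕ → Set} {ρ} → (∀ {σ} → S σ → IsPerm n σ) →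
                          S ρ → (∀ σ → S σ → ρ ≼ σ) → IsUniqueMinimal S ρ
  least⇒IsUniqueMinimal perm Sρ least =
    (Sρ , λ σ Sσ σ≤ρ → IsPerm-≼-antisym (perm Sσ) (perm Sρ) (≤w⇒≼ σ≤ρ) (least σ Sσ)) ,
    λ σ (Sσ , minimal) → sym (minimal _ Sρ (≼⇒≤w (least σ Sσ)))

  Covers-reverse : ∀ {σ τ} → Covers n σ τ → Covers n (reverse τ) (reverse σ)
  Covers-reverse {σ} {τ} (pσ , pτ , σ≤τ , σ≢τ , between) =
    IsPerm-reverse pτ , IsPerm-reverse pσ , ≼⇒≤w (≼-reverse pσ pτ (≤w⇒≼ σ≤τ)) ,
    (λ τʳ≡σʳ → σ≢τ (sym (reverse-injective τʳ≡σʳ))) , between′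
    where
    between′ : ∀ ρ → IsPerm n ρ → reverse τ ≤w ρ → ρ ≤w reverse σ →
               ρ ≡ reverse τ ⊎ ρ ≡ reverse σ
    between′ ρ pρ τʳ≤ρ ρ≤σʳ =
      Sum.swap (Sum.map (λ eq → sym (reverse-selfInverse eq)) (λ eq → sym (reverse-selfInverse eq))
        (between (reverse ρ) (IsPerm-reverse pρ) (≼⇒≤w (≼-reverseʳ pρ pσ (≤w⇒≼ ρ≤σʳ)))
                                                 (≼⇒≤w (≼-reverseˡ pτ pρ (≤w⇒≼ τʳ≤ρ)))))

  KappaVee-reverse : ∀ {σ τ} → KappaVee n (reverse σ) (reverse τ) → KappaWedge n σ τ
  KappaVee-reverse {σ} {τ} (pσʳ , μ , σʳ⋖μ , upper-unique , (Sτʳ , minimal) , minimum-unique) =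
    IsPerm-reverse⁻ pσʳ , reverse μ ,
    subst (Covers n (reverse μ)) (reverse-involutive σ) (Covers-reverse σʳ⋖μ) ,
    (λ ρ ρ⋖σ → sym (reverse-selfInverse (upper-unique (reverse ρ) (Covers-reverse ρ⋖σ)))) ,
    (subst T (reverse-involutive τ) (S⇒T Sτʳ) , maximal) , maximum-unique
    where
    S T : List ℕ → Set
    S ρ = IsPerm n ρ × ρ ≤w μ × ¬ (ρ ≤w reverse σ)
    T ρ = IsPerm n ρ × reverse μ ≤w ρ × ¬ (σ ≤w ρ)
    pσ = IsPerm-reverse⁻ pσʳ
    pμ = proj₁ (proj₂ σʳ⋖μ)
    S⇒T : ∀ {ρ} → S ρ → T (reverse ρ)
    S⇒T (pρ , ρ≤μ , ρ≰σʳ) =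
      IsPerm-reverse pρ , ≼⇒≤w (≼-reverse pρ pμ (≤w⇒≼ ρ≤μ)) ,
      λ σ≤ρʳ → ρ≰σʳ (≼⇒≤w (≼-reverseʳ pσ pρ (≤w⇒≼ σ≤ρʳ)))
    T⇒S : ∀ {ρ} → T ρ → S (reverse ρ)
    T⇒S (pρ , μʳ≤ρ , σ≰ρ) =
      IsPerm-reverse pρ , ≼⇒≤w (≼-reverseˡ pμ pρ (≤w⇒≼ μʳ≤ρ)) ,
      λ ρʳ≤σʳ → σ≰ρ (≼⇒≤w (reverse-≼ pρ pσ (≤w⇒≼ ρʳ≤σʳ)))
    maximal : ∀ ρ → T ρ → τ ≤w ρ → ρ ≡ τ
    maximal ρ Tρ τ≤ρ = reverse-injective (minimal (reverse ρ) (T⇒S Tρ)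
      (≼⇒≤w (≼-reverse (IsPerm-reverse⁻ (proj₁ Sτʳ)) (proj₁ Tρ) (≤w⇒≼ τ≤ρ))))
    maximum-unique : ∀ ρ → IsMaximal T ρ → ρ ≡ τ
    maximum-unique ρ (Tρ , ρ-maximal) =
      reverse-injective (minimum-unique (reverse ρ) (T⇒S Tρ , ρʳ-minimal))
      where
      ρʳ-minimal : ∀ ω → S ω → ω ≤w reverse ρ → ω ≡ reverse ρ
      ρʳ-minimal ω Sω ω≤ρʳ = sym (reverse-selfInverse
        (ρ-maximal (reverse ω) (S⇒T Sω) (≼⇒≤w (≼-reverseʳ (proj₁ Sω) (proj₁ Tρ) (≤w⇒≼ ω≤ρʳ)))))

Arranged : List ℕ → List ℕ → ℕ → ℕ → List ℕ → Set
Arranged σ Y x y Z =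
  (∀ {i} → i ∈ Y → Before σ i x) × Before σ x y × (∀ {k} → k ∈ Z → Before σ y k)

Arranged-layout : ∀ X Y {x y} Z → Arranged (X ++ Y ++ x ∷ y ∷ Z) Y x y Z
Arranged-layout X Y Z =
  (λ i∈Y → Before-++⁺ʳ X (Before-++⁺ i∈Y (here refl))) ,
  Before-++⁺ʳ X (Before-++⁺ʳ Y (first (here refl))) ,
  (λ k∈Z → Before-++⁺ʳ X (Before-++⁺ʳ Y (later (first k∈Z))))

Arranged-⊆ : ∀ {σ Y Y′ x y Z Z′} → Y′ ⊆ Y → Z′ ⊆ Z →
             Arranged σ Y x y Z → Arranged σ Y′ x y Z′
Arranged-⊆ Y′⊆Y Z′⊆Z (Y≺x , x≺y , y≺Z) =
  (λ i∈Y′ → Y≺x (Y′⊆Y i∈Y′)) , x≺y , (λ k∈Z′ → y≺Z (Z′⊆Z k∈Z′))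

Arranged-reverse : ∀ {σ Y x y Z} → Arranged σ Y x y Z → Arranged (reverse σ) Z y x Y
Arranged-reverse (Y≺x , x≺y , y≺Z) =
  (λ k∈Z → Before-reverse⁺ (y≺Z k∈Z)) , Before-reverse⁺ x≺y ,
  (λ i∈Y → Before-reverse⁺ (Y≺x i∈Y))

Arc-flip : ∀ {n} → Arc n → Arc n
Arc-flip α = record α { A = Arc.B α ; B = Arc.A α ; A-incr = Arc.B-incr α ; B-incr = Arc.A-incr α
                      ; partition = ↭-trans (++-comm (Arc.B α) (Arc.A α)) (Arc.partition α) }

module _ {n : ℕ} (α : Arc n) where
  open Arc α

  prefix suffix : List ℕ
  prefix = [1‥ (a ∸ 1) ]
  suffix = [ b +1‥+ (n ∸ b) ]

  A-between : ∀ {i} → i ∈ A → a < i × i < b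
  A-between i∈A = ∈-[+1‥+]-gap a<b (∈-resp-↭ partition (∈-++⁺ˡ i∈A))

  B-between : ∀ {k} → k ∈ B → a < k × k < b
  B-between k∈B = ∈-[+1‥+]-gap a<b (∈-resp-↭ partition (∈-++⁺ʳ A k∈B))

  prefix-below : ∀ {i} → i ∈ prefix → i < a
  prefix-below i∈ = ≤-trans (s≤s (proj₂ (∈-[+1‥+]⁻ i∈))) (≤-reflexive (m+[n∸m]≡n 1≤a))

  suffix-above : ∀ {k} → k ∈ suffix → b < k
  suffix-above k∈ = proj₁ (∈-[+1‥+]⁻ k∈)

  σ∨-perm : IsPerm n (σ∨ α)
  σ∨-perm = begin
    prefix ++ A ++ b ∷ a ∷ B ++ suffix
      ↭⟨ solve 6 (λ P A B S a b → P ⊕ A ⊕ b ⊕ a ⊕ B ⊕ S ⊜ P ⊕ a ⊕ (A ⊕ B) ⊕ b ⊕ S) ↭-refl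
                 prefix A B suffix [ a ] [ b ] ⟩
    prefix ++ a ∷ (A ++ B) ++ b ∷ suffix
      ↭⟨ ++⁺ˡ prefix (prep a (++⁺ʳ (b ∷ suffix) partition)) ⟩
    prefix ++ a ∷ [ a +1‥+ (b ∸ a ∸ 1) ] ++ b ∷ suffix
      ≡⟨ sym ([1‥]-decompose 1≤a a<b b≤n) ⟩
    [1‥ n ] ∎
    where open PermutationReasoning

  reverse-σ∨ : reverse (σ∨ α) ≡ σ∧ (Arc-flip α)
  reverse-σ∨ = begin
    reverse (prefix ++ A ++ b ∷ a ∷ B ++ suffix)
      ≡⟨ reverse-++ prefix _ ⟩
    reverse (A ++ b ∷ a ∷ B ++ suffix) ++ Pʳ
      ≡⟨ cong (_++ Pʳ) (reverse-++ A _) ⟩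
    (reverse (b ∷ a ∷ B ++ suffix) ++ reverse A) ++ Pʳ
      ≡⟨ ++-assoc _ (reverse A) Pʳ ⟩
    reverse (b ∷ a ∷ B ++ suffix) ++ reverse A ++ Pʳ
      ≡⟨ cong (_++ reverse A ++ Pʳ) (reverse-++ (b ∷ a ∷ []) (B ++ suffix)) ⟩
    (reverse (B ++ suffix) ++ a ∷ b ∷ []) ++ reverse A ++ Pʳ
      ≡⟨ ++-assoc (reverse (B ++ suffix)) _ _ ⟩
    reverse (B ++ suffix) ++ a ∷ b ∷ reverse A ++ Pʳ
      ≡⟨ cong (_++ a ∷ b ∷ reverse A ++ Pʳ) (reverse-++ B suffix) ⟩
    (reverse suffix ++ reverse B) ++ a ∷ b ∷ reverse A ++ Pʳ
      ≡⟨ ++-assoc (reverse suffix) _ _ ⟩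
    reverse suffix ++ reverse B ++ a ∷ b ∷ reverse A ++ Pʳ ∎
    where
    open ≡-Reasoning
    Pʳ = reverse prefix

  a<B++suffix : ∀ {u} → u ∈ B ++ suffix → a < u
  a<B++suffix u∈ with ∈-++⁻ B u∈
  ... | inj₁ u∈B = proj₁ (B-between u∈B)
  ... | inj₂ u∈S = <-trans a<b (suffix-above u∈S)

  B++suffix-<b : ∀ {u} → u ∈ B ++ suffix → u < b → u ∈ B
  B++suffix-<b u∈ u<b with ∈-++⁻ B u∈
  ... | inj₁ u∈B = u∈B
  ... | inj₂ u∈S = ⊥-elim (<-asym u<b (suffix-above u∈S))

  B++suffix-sorted : ∀ {x y} → Before (B ++ suffix) x y → x < y
  B++suffix-sorted p with Before-++⁻ B p
  ... | inj₁ q = AllPairs-Before B-incr q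
  ... | inj₂ (inj₁ (x∈B , y∈S)) = <-trans (proj₂ (B-between x∈B)) (suffix-above y∈S)
  ... | inj₂ (inj₂ q) = AllPairs-Before ([+1‥+]-sorted b _) q

  a≤-after-prefix : ∀ {u} → u ∈ A ++ b ∷ a ∷ B ++ suffix → a ≤ u
  a≤-after-prefix u∈ with ∈-++⁻ A u∈
  ... | inj₁ u∈A = <⇒≤ (proj₁ (A-between u∈A))
  ... | inj₂ (here refl) = <⇒≤ a<b
  ... | inj₂ (there (here refl)) = ≤-refl
  ... | inj₂ (there (there u∈BS)) = <⇒≤ (a<B++suffix u∈BS)

  ba-inversion : ∀ {u v} → u < v → Before (b ∷ a ∷ B ++ suffix) v u →
                 v ≡ b × (u ≡ a ⊎ u ∈ B)
  ba-inversion u<v (first (here refl)) = refl , inj₁ refl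
  ba-inversion u<v (first (there u∈BS)) = refl , inj₂ (B++suffix-<b u∈BS u<v)
  ba-inversion u<v (later (first u∈BS)) = ⊥-elim (<-asym u<v (a<B++suffix u∈BS))
  ba-inversion u<v (later (later p)) = ⊥-elim (<-asym u<v (B++suffix-sorted p))

  σ∨-inversion : ∀ {u v} → u < v → Before (σ∨ α) v u →
                 (v ∈ A ⊎ v ≡ b) × (u ≡ a ⊎ u ∈ B)
  σ∨-inversion u<v p with Before-++⁻ prefix p
  ... | inj₁ q = ⊥-elim (<-asym u<v (AllPairs-Before ([+1‥+]-sorted 0 _) q))
  ... | inj₂ (inj₁ (v∈P , u∈R)) =
        ⊥-elim (<-asym u<v (<-≤-trans (prefix-below v∈P) (a≤-after-prefix u∈R)))
  ... | inj₂ (inj₂ q) with Before-++⁻ A q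
  ...   | inj₁ r = ⊥-elim (<-asym u<v (AllPairs-Before A-incr r))
  ...   | inj₂ (inj₁ (v∈A , here refl)) = ⊥-elim (<-asym u<v (proj₂ (A-between v∈A)))
  ...   | inj₂ (inj₁ (v∈A , there (here refl))) = inj₁ v∈A , inj₁ refl
  ...   | inj₂ (inj₁ (v∈A , there (there u∈BS))) =
          inj₁ v∈A , inj₂ (B++suffix-<b u∈BS (<-trans u<v (proj₂ (A-between v∈A))))
  ...   | inj₂ (inj₂ r) = Product.map₁ inj₂ (ba-inversion u<v r)

  σ∨-least : ∀ {σ} → Unique σ → Arranged σ A b a B → σ∨ α ≼ σ
  σ∨-least uσ (A≺b , b≺a , a≺B) u<v p with σ∨-inversion u<v p
  ... | inj₁ v∈A , inj₁ refl = Before-trans uσ (A≺b v∈A) b≺a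
  ... | inj₁ v∈A , inj₂ u∈B = Before-trans uσ (A≺b v∈A) (Before-trans uσ b≺a (a≺B u∈B))
  ... | inj₂ refl , inj₁ refl = b≺a
  ... | inj₂ refl , inj₂ u∈B = Before-trans uσ b≺a (a≺B u∈B)

  σ∨-b≺a : Before (σ∨ α) b a
  σ∨-b≺a = proj₁ (proj₂ (Arranged-layout prefix A (B ++ suffix)))

  Arranged-≼ : ∀ {σ τ} → IsPerm n σ → IsPerm n τ → σ ≼ τ →
               Arranged τ A b a B → Before σ b a → Arranged σ A b a B
  Arranged-≼ pσ pτ σ≼τ (A≺b , _ , a≺B) σba =
    (λ i∈A → IsPerm-≼-ascent pσ pτ σ≼τ (proj₂ (A-between i∈A)) (A≺b i∈A)) , σba ,
    (λ k∈B → IsPerm-≼-ascent pσ pτ σ≼τ (proj₁ (B-between k∈B)) (a≺B k∈B))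

  Arranged-≽ : ∀ {σ τ} → τ ≼ σ → Arranged τ A a b B → Before σ a b → Arranged σ A a b B
  Arranged-≽ τ≼σ (A≺a , _ , b≺B) σab =
    (λ i∈A → τ≼σ (proj₁ (A-between i∈A)) (A≺a i∈A)) , σab ,
    (λ k∈B → τ≼σ (proj₂ (B-between k∈B)) (b≺B k∈B))

module _ {n : ℕ} (α : Arc n) where
  open Arc α

  σ∧[_,_] : ℕ → ℕ → List ℕ
  σ∧[ x , y ] = reverse (suffix α) ++ reverse A ++ x ∷ y ∷ reverse B ++ reverse (prefix α)

  Arranged-σ∧[,] : ∀ {x y} → Arranged σ∧[ x , y ] A x y B
  Arranged-σ∧[,] =
    Arranged-⊆ Any.reverse⁺ (λ k∈B → ∈-++⁺ˡ (Any.reverse⁺ k∈B))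
               (Arranged-layout (reverse (suffix α)) (reverse A) (reverse B ++ reverse (prefix α)))

  σ∧-perm : IsPerm n (σ∧ α)
  σ∧-perm = subst (IsPerm n) (reverse-σ∨ (Arc-flip α)) (IsPerm-reverse (σ∨-perm (Arc-flip α)))

  σ∧-greatest : ∀ {σ} → IsPerm n σ → Arranged σ A a b B → σ ≼ σ∧ α
  σ∧-greatest pσ σ-arranged = subst (_ ≼_) (reverse-σ∨ (Arc-flip α))
    (≼-reverseʳ (σ∨-perm (Arc-flip α)) pσ
      (σ∨-least (Arc-flip α) (IsPerm⇒Unique (IsPerm-reverse pσ)) (Arranged-reverse σ-arranged)))

  KappaVee-σ∧-σ∨ : KappaVee n (σ∧ α) (σ∨ α)
  KappaVee-σ∧-σ∨ =
    σ∧-perm , m* , m⋖m* , Transposition-unique-cover a<b σ∧-perm t maximal ,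
    least⇒IsUniqueMinimal proj₁ σ∨-in below-m*-least
    where
    m* = σ∧[ b , a ]
    t : Transposition a b (σ∧ α) m*
    t = Transposition-++ (reverse (suffix α)) (Transposition-++ (reverse A) swap-head)
    m⋖m* = Transposition-Covers a<b σ∧-perm t
    pm* = Transposition-IsPerm σ∧-perm t
    maximal : ∀ σ → IsPerm n σ → σ∧ α ≼ σ → Before σ a b → σ ≼ σ∧ α
    maximal σ pσ m≼σ σab = σ∧-greatest pσ (Arranged-≽ α m≼σ Arranged-σ∧[,] σab)
    σ∨-in : IsPerm n (σ∨ α) × σ∨ α ≤w m* × ¬ (σ∨ α ≤w σ∧ α)
    σ∨-in = σ∨-perm α , ≼⇒≤w (σ∨-least α (IsPerm⇒Unique pm*) Arranged-σ∧[,]) ,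
            λ σ∨≤m → Before-asym (IsPerm⇒Unique σ∧-perm) (proj₁ (proj₂ Arranged-σ∧[,]))
                                  (≤w⇒≼ σ∨≤m a<b (σ∨-b≺a α))
    below-m*-least : ∀ σ → IsPerm n σ × σ ≤w m* × ¬ (σ ≤w σ∧ α) → σ∨ α ≼ σ
    below-m*-least σ (pσ , σ≤m* , σ≰m) = σ∨-least α (IsPerm⇒Unique pσ)
      (Arranged-≼ α pσ pm* (≤w⇒≼ σ≤m*) Arranged-σ∧[,]
        (Transposition-¬≼ a<b σ∧-perm pσ t (≤w⇒≼ σ≤m*) (λ σ≼m → σ≰m (≼⇒≤w σ≼m))))

reverse-σ∧ : ∀ {n} (α : Arc n) → reverse (σ∧ α) ≡ σ∨ (Arc-flip α)
reverse-σ∧ α = reverse-selfInverse (reverse-σ∨ (Arc-flip α))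

proposition3p5 : (n : ℕ) (α : Arc n) →
    KappaVee n (σ∧ α) (σ∨ α) × KappaWedge n (σ∨ α) (σ∧ α)
proposition3p5 n α =
  KappaVee-σ∧-σ∨ α ,
  KappaVee-reverse (subst₂ (KappaVee n) (sym (reverse-σ∨ α)) (sym (reverse-σ∧ α))
                           (KappaVee-σ∧-σ∨ (Arc-flip α)))
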